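{- Let $\pi$ be a permutation that has at least three left to right maxima, and such that the third left to right maximum of $\pi$ is not the final term of $\pi$. Then $B^{ -1}(\mathrm{Av}(\pi))$ is not a pattern class.
   Context: Permutations are sequences of length $n\ge 1$ using each of $1,\ldots,n$ exactly once. For any finite sequence of distinct numbers, the one-pass bubble sort operator $B$ is defined recursively by $B(\epsilon)=\epsilon$ for the empty sequence, and, writing a non-empty sequence as $\sigma=\sigma_1 m\sigma_2$ with $m$ its largest term, $B(\sigma)=B(\sigma_1)\sigma_2 m$. A permutation $\sigma$ is a subpermutation of $\tau$, written $\sigma\preceq\tau$, if $\tau$ has a (not necessarily consecutive) subsequence order isomorphic to $\sigma$. A pattern class is a set of permutations closed downward under $\preceq$. For a set $M$ of permutations, $\mathrm{Av}(M)=\{\beta:\mu\not\preceq\beta \text{ for all } \mu\in M\}$, and $\mathrm{Av}(\pi)=\mathrm{Av}(\{\pi\})$. For a set $X$ of permutations, $B^{ -1}(X)=\{\sigma : B(\sigma)\in X\}$. A left to right maximum of a sequence is a term larger than every term preceding it. -}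

module Defs where

open import Data.Nat using (ℕ; zero; suc; _<_; _≤_; _⊔_; _≟_)
open import Data.List using (List; []; _∷_; _++_; [_]; length; lookup; map; upTo; foldr)
open import Data.List.Relation.Binary.Permutation.Propositional using (_↭_)
open import Data.List.Relation.Binary.Sublist.Propositional using (_⊆_)
open import Data.Fin as Fin using (Fin; cast)
open import Data.Product using (Σ; _×_; _,_; ∃)
open import Data.Sum using (_⊎_)
open import Relation.Nullary using (¬_; yes; no)
open import Relation.Binary.PropositionalEquality using (_≡_)
open import Function.Bundles using (_⇔_)

IsPerm : List ℕ → Set
IsPerm xs = (1 ≤ length xs) × (xs ↭ map suc (upTo (length xs)))

maxL : List ℕ → ℕ
maxL = foldr _⊔_ 0

splitAt= : ℕ → List ℕ → List ℕ × List ℕ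
splitAt= m [] = [] , []
splitAt= m (x ∷ xs) with x ≟ m
... | yes _ = [] , xs
... | no _ with splitAt= m xs
...   | (a , b) = x ∷ a , b

-- one-pass bubble sort, B(σ₁ m σ₂) = B(σ₁) σ₂ m, with fuel (σ₁ is shorter than σ)
B-fuel : ℕ → List ℕ → List ℕ
B-fuel _ [] = []
B-fuel zero (x ∷ xs) = x ∷ xs   -- never reached with sufficient fuel
B-fuel (suc k) (x ∷ xs) with splitAt= (maxL (x ∷ xs)) (x ∷ xs)
... | (σ₁ , σ₂) = B-fuel k σ₁ ++ (σ₂ ++ [ maxL (x ∷ xs) ])

B : List ℕ → List ℕ
B xs = B-fuel (length xs) xs

OrderIso : List ℕ → List ℕ → Set
OrderIso xs ys =
  Σ (length xs ≡ length ys) λ eq →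
    ∀ (i j : Fin (length xs)) →
      (lookup xs i < lookup xs j) ⇔ (lookup ys (cast eq i) < lookup ys (cast eq j))

_⪯_ : List ℕ → List ℕ → Set
σ ⪯ τ = ∃ λ ys → (ys ⊆ τ) × OrderIso σ ys

PermSet : Set₁
PermSet = List ℕ → Set

IsPatternClass : PermSet → Set
IsPatternClass C =
  (∀ τ → C τ → IsPerm τ) ×
  (∀ σ τ → IsPerm σ → σ ⪯ τ → C τ → C σ)

Av : List ℕ → PermSet
Av π β = IsPerm β × ¬ (π ⪯ β)

Binv : PermSet → PermSet
Binv X σ = IsPerm σ × X (B σ)

IsLRMax : (xs : List ℕ) → Fin (length xs) → Set
IsLRMax xs i = ∀ (j : Fin (length xs)) → j Fin.< i → lookup xs j < lookup xs i

ThirdLRMaxNotLast : List ℕ → Set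
ThirdLRMaxNotLast xs =
  Σ (Fin (length xs)) λ i₁ → Σ (Fin (length xs)) λ i₂ → Σ (Fin (length xs)) λ i₃ →
    (i₁ Fin.< i₂) × (i₂ Fin.< i₃) ×
    IsLRMax xs i₁ × IsLRMax xs i₂ × IsLRMax xs i₃ ×
    (∀ j → j Fin.< i₃ → IsLRMax xs j → (j ≡ i₁) ⊎ (j ≡ i₂)) ×
    (suc (Fin.toℕ i₃) < length xs)

-- Write π = h b r e, where b is the second left-to-right maximum, so that the prefix h is nonempty
-- and lies below b, and the third left-to-right maximum sits inside r. Let G = e if e is the largest
-- entry of π and G = |π| + 1 otherwise, and σ = b h G r′ with r′ = r, respectively r′ = r e. One pass
-- of bubble sort carries b back behind h and G to the end, so B(σ) = h b r′ G contains π and σ is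
-- not in B⁻¹(Av π). For a new largest value X, τ = X σ has B(τ) = σ X, so it suffices that σ X
-- avoids π. A copy of π in σ X ends in X only if e is the largest entry of π, so it misses exactly
-- one entry of σ X, respectively of σ. If that entry comes after b h, then b and the last entry of
-- h stay at positions 0 and |h|, against π(0) < b; otherwise G moves to position |h| and an entry
-- of r to the position t of the third maximum, against b < π(t).

module Submission where

open import Data.Empty using (⊥; ⊥-elim)
open import Data.Fin as Fin using (Fin; cast; toℕ)
open import Data.Fin.Properties using (toℕ-cast; cast-is-id; cast-involutive)
open import Data.List using (List; []; _∷_; _++_; [_]; length; lookup; map; upTo; initLast; _∷ʳ′_)
open import Data.List.Properties
  using (++-assoc; length-++; length-++-sucʳ; length-map; length-upTo; map-++; applyUpTo-∷ʳ; foldr-preservesᵇ; foldr-preservesᵒ)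
open import Data.List.Membership.Propositional.Properties using (∈-upTo⁻)
open import Data.List.Relation.Binary.Equality.Propositional using (≋⇒≡)
open import Data.List.Relation.Binary.Permutation.Propositional using (_↭_; ↭-sym; ↭-trans; prep)
open import Data.List.Relation.Binary.Permutation.Propositional.Properties
  using (↭-length; ++⁺ˡ; ++⁺ʳ; shift; ∷↭∷ʳ; All-resp-↭)
open import Data.List.Relation.Binary.Sublist.Propositional using (_⊆_; []; _∷_; _∷ʳ_; ⊆-refl; ⊆-reflexive)
open import Data.List.Relation.Binary.Sublist.Propositional.Properties as Sublist using (All-resp-⊆; to-≋)
open import Data.List.Relation.Unary.All as All using (All; []; _∷_; all?)
import Data.List.Relation.Unary.All.Properties as All
import Data.List.Relation.Unary.Any as Any
import Data.List.Relation.Unary.Any.Properties as Any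
open import Data.Nat using (ℕ; zero; suc; _<_; _≤_; _⊔_; _≟_; z≤n; s≤s; s<s⁻¹; _<?_)
open import Data.Nat.Properties
open import Data.Product using (_×_; _,_; ∃; ∃₂; proj₁; proj₂)
open import Data.Sum using (_⊎_; inj₁; inj₂; [_,_]′)
open import Function using (_∘_)
open import Function.Bundles using (_⇔_; Equivalence)
open import Function.Construct.Identity using (⇔-id)
open import Function.Construct.Symmetry using (⇔-sym)
open import Relation.Nullary using (¬_; yes; no)
open import Relation.Binary.PropositionalEquality hiding ([_])

open import Defs

length-∷ʳ : ∀ (xs : List ℕ) x → length (xs ++ [ x ]) ≡ suc (length xs)
length-∷ʳ xs x = trans (length-++ xs) (+-comm (length xs) 1)

maxL-≤ : ∀ {m} {xs : List ℕ} → All (_≤ m) xs → maxL xs ≤ m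
maxL-≤ = foldr-preservesᵇ ⊔-lub z≤n

maxL-≥ : ∀ {m} (σ₁ σ₂ : List ℕ) → m ≤ maxL (σ₁ ++ m ∷ σ₂)
maxL-≥ {m} σ₁ σ₂ = foldr-preservesᵒ {P = m ≤_} {f = _⊔_}
  (λ x y → [ m≤n⇒m≤n⊔o y , m≤n⇒m≤o⊔n x ]′) 0 (σ₁ ++ _ ∷ σ₂)
  (inj₂ (Any.++⁺ʳ σ₁ (Any.here ≤-refl)))

maxL-peak : ∀ {m} {σ₁ σ₂ : List ℕ} → All (_< m) σ₁ → All (_≤ m) σ₂ → maxL (σ₁ ++ m ∷ σ₂) ≡ m
maxL-peak {σ₁ = σ₁} {σ₂} σ₁<m σ₂≤m = ≤-antisym
  (maxL-≤ (All.++⁺ (All.map <⇒≤ σ₁<m) (≤-refl ∷ σ₂≤m)))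
  (maxL-≥ σ₁ σ₂)

splitAt=-first : ∀ {m} {σ₁ : List ℕ} σ₂ → All (_< m) σ₁ → splitAt= m (σ₁ ++ m ∷ σ₂) ≡ (σ₁ , σ₂)
splitAt=-first {m} σ₂ [] with m ≟ m
... | yes _ = refl
... | no m≢m = ⊥-elim (m≢m refl)
splitAt=-first {m} {x ∷ σ₁} σ₂ (x<m ∷ σ₁<m) with x ≟ m
... | yes refl = ⊥-elim (<-irrefl refl x<m)
... | no _ rewrite splitAt=-first σ₂ σ₁<m = refl

B-fuel-unfold : ∀ k {m} σ₁ σ₂ → All (_< m) σ₁ → All (_≤ m) σ₂ →
  B-fuel (suc k) (σ₁ ++ m ∷ σ₂) ≡ B-fuel k σ₁ ++ σ₂ ++ [ m ]
B-fuel-unfold k [] σ₂ σ₁<m σ₂≤m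
  rewrite maxL-peak σ₁<m σ₂≤m | splitAt=-first σ₂ σ₁<m = refl
B-fuel-unfold k (x ∷ σ₁) σ₂ σ₁<m σ₂≤m
  rewrite maxL-peak σ₁<m σ₂≤m | splitAt=-first σ₂ σ₁<m = refl

B-max-first : ∀ {m} σ → All (_≤ m) σ → B (m ∷ σ) ≡ σ ++ [ m ]
B-max-first σ = B-fuel-unfold (length σ) [] σ []

B-lift : ∀ {b G} h R → All (_< b) h → All (_< G) (b ∷ h) → All (_≤ G) R →
  B (b ∷ h ++ G ∷ R) ≡ h ++ b ∷ R ++ [ G ]
B-lift {b} {G} h R h<b bh<G R≤G = begin
  B-fuel (suc (length (h ++ G ∷ R))) ((b ∷ h) ++ G ∷ R)
    ≡⟨ B-fuel-unfold (length (h ++ G ∷ R)) (b ∷ h) R bh<G R≤G ⟩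
  B-fuel (length (h ++ G ∷ R)) (b ∷ h) ++ R ++ [ G ]
    ≡⟨ cong (λ k → B-fuel k (b ∷ h) ++ R ++ [ G ]) (length-++-sucʳ h G R) ⟩
  B-fuel (suc (length (h ++ R))) (b ∷ h) ++ R ++ [ G ]
    ≡⟨ cong (_++ R ++ [ G ]) (B-fuel-unfold (length (h ++ R)) [] h [] (All.map <⇒≤ h<b)) ⟩
  (h ++ [ b ]) ++ R ++ [ G ]
    ≡⟨ ++-assoc h [ b ] (R ++ [ G ]) ⟩
  h ++ b ∷ R ++ [ G ] ∎
  where open ≡-Reasoning

lift↭ : ∀ {b G : ℕ} h R → b ∷ h ++ G ∷ R ↭ h ++ b ∷ R ++ [ G ]
lift↭ {b} {G} h R = ↭-trans (↭-sym (shift b h (G ∷ R))) (++⁺ˡ h (prep b (∷↭∷ʳ G R)))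

-- Positions are plain naturals rather than Fin, so shifting a position needs no casts.
infix 4 _[_]=_

data _[_]=_ : List ℕ → ℕ → ℕ → Set where
  here  : ∀ {x xs} → (x ∷ xs) [ 0 ]= x
  there : ∀ {y xs k v} → xs [ k ]= v → (y ∷ xs) [ suc k ]= v

[]=-functional : ∀ {xs k u v} → xs [ k ]= u → xs [ k ]= v → u ≡ v
[]=-functional here      here      = refl
[]=-functional (there p) (there q) = []=-functional p q

[]=-bound : ∀ {xs k v} → xs [ k ]= v → k < length xs
[]=-bound here      = s≤s z≤n
[]=-bound (there p) = s≤s ([]=-bound p)

[]=-exists : ∀ xs {k} → k < length xs → ∃ (xs [ k ]=_)
[]=-exists (x ∷ xs) {zero}  _         = x , here
[]=-exists (x ∷ xs) {suc k} (s≤s k<n) = let v , p = []=-exists xs k<n in v , there p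

[]=-++ˡ : ∀ {xs k v} ys → xs [ k ]= v → (xs ++ ys) [ k ]= v
[]=-++ˡ ys here      = here
[]=-++ˡ ys (there p) = there ([]=-++ˡ ys p)

[]=-++-mid : ∀ (xs : List ℕ) {y ys} → (xs ++ y ∷ ys) [ length xs ]= y
[]=-++-mid []       = here
[]=-++-mid (x ∷ xs) = there ([]=-++-mid xs)

All-[]= : ∀ {P : ℕ → Set} {xs k v} → All P xs → xs [ k ]= v → P v
All-[]= (p ∷ _)  here      = p
All-[]= (_ ∷ ps) (there q) = All-[]= ps q

[]=⇒All : ∀ {P : ℕ → Set} xs → (∀ {k v} → xs [ k ]= v → P v) → All P xs
[]=⇒All []       f = []
[]=⇒All (x ∷ xs) f = f here ∷ []=⇒All xs (f ∘ there)

lookup-[]= : ∀ xs (i : Fin (length xs)) → xs [ toℕ i ]= lookup xs i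
lookup-[]= (x ∷ xs) Fin.zero    = here
lookup-[]= (x ∷ xs) (Fin.suc i) = there (lookup-[]= xs i)

[]=⇒lookup : ∀ {xs k v} → xs [ k ]= v → ∃ λ i → toℕ i ≡ k × lookup xs i ≡ v
[]=⇒lookup here      = Fin.zero , refl , refl
[]=⇒lookup (there p) = let i , i≡k , xᵢ≡v = []=⇒lookup p in Fin.suc i , cong suc i≡k , xᵢ≡v

[]=-below-peak : ∀ {G k v} xs {ys} → All (_< G) xs → All (_< G) ys →
  (xs ++ G ∷ ys) [ k ]= v → k ≢ length xs → v < G
[]=-below-peak []       _              ys<G here      k≢0 = ⊥-elim (k≢0 refl)
[]=-below-peak []       _              ys<G (there p) _   = All-[]= ys<G p
[]=-below-peak (x ∷ xs) (x<G ∷ _)      _    here      _   = x<G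
[]=-below-peak (x ∷ xs) (_   ∷ xs<G)   ys<G (there p) k≢  = []=-below-peak xs xs<G ys<G p (k≢ ∘ cong suc)

EntryLt : List ℕ → ℕ → ℕ → Set
EntryLt xs k l = ∃₂ λ u v → xs [ k ]= u × xs [ l ]= v × u < v

EntryLt⇒< : ∀ {xs k l u v} → EntryLt xs k l → xs [ k ]= u → xs [ l ]= v → u < v
EntryLt⇒< (_ , _ , p , q , lt) p′ q′ = subst₂ _<_ ([]=-functional p p′) ([]=-functional q q′) lt

EntryLt-asym : ∀ {xs k l} → EntryLt xs k l → EntryLt xs l k → ⊥
EntryLt-asym k<l (_ , _ , p , q , lt) = <-asym lt (EntryLt⇒< k<l q p)

EntryLt-map : ∀ {xs ys k l k′ l′} → (∀ {v} → xs [ k ]= v → ys [ k′ ]= v) →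
  (∀ {v} → xs [ l ]= v → ys [ l′ ]= v) → EntryLt xs k l → EntryLt ys k′ l′
EntryLt-map f g (u , v , p , q , lt) = u , v , f p , g q , lt

OrderIso-refl : ∀ xs → OrderIso xs xs
OrderIso-refl xs = refl , λ i j →
  subst₂ (λ i′ j′ → (lookup xs i < lookup xs j) ⇔ (lookup xs i′ < lookup xs j′))
    (sym (cast-is-id refl i)) (sym (cast-is-id refl j)) (⇔-id _)

OrderIso-sym : ∀ {xs ys} → OrderIso xs ys → OrderIso ys xs
OrderIso-sym {xs} {ys} (eq , iso) = sym eq , λ i j → ⇔-sym
  (subst₂ (λ i′ j′ → (lookup xs (cast (sym eq) i) < lookup xs (cast (sym eq) j)) ⇔ (lookup ys i′ < lookup ys j′))
    (cast-involutive eq (sym eq) i) (cast-involutive eq (sym eq) j)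
    (iso (cast (sym eq) i) (cast (sym eq) j)))

OrderIso⇒EntryLt : ∀ {xs ys k l} → OrderIso xs ys → EntryLt xs k l → EntryLt ys k l
OrderIso⇒EntryLt {xs} {ys} (eq , iso) (_ , _ , p , q , lt)
  with i , refl , refl ← []=⇒lookup p | j , refl , refl ← []=⇒lookup q
  = _ , _ , at i , at j , Equivalence.to (iso i j) lt
  where
  at : ∀ i → ys [ toℕ i ]= lookup ys (cast eq i)
  at i = subst (ys [_]= lookup ys (cast eq i)) (toℕ-cast eq i) (lookup-[]= ys (cast eq i))

⊆⇒⪯ : ∀ {xs ys} → xs ⊆ ys → xs ⪯ ys
⊆⇒⪯ {xs} s = xs , s , OrderIso-refl xs

⊆-one-shorter : ∀ {ys w : List ℕ} → ys ⊆ w → suc (length ys) ≡ length w →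
  ∃ λ d → (∀ {k v} → ys [ k ]= v → k < d → w [ k ]= v)
        × (∀ {k v} → ys [ k ]= v → d ≤ k → w [ suc k ]= v)
⊆-one-shorter (y ∷ʳ s) eq with refl ← ≋⇒≡ (to-≋ (suc-injective eq) s) = 0 , (λ _ ()) , (λ p _ → there p)
⊆-one-shorter {x ∷ ys} {_ ∷ w} (refl ∷ s) eq
  with d , before , after ← ⊆-one-shorter s (suc-injective eq) = suc d , before′ , after′
  where
  before′ : ∀ {k v} → (x ∷ ys) [ k ]= v → k < suc d → (x ∷ w) [ k ]= v
  before′ here      _         = here
  before′ (there p) (s≤s k<d) = there (before p k<d)
  after′ : ∀ {k v} → (x ∷ ys) [ k ]= v → suc d ≤ k → (x ∷ w) [ suc k ]= v
  after′ (there p) (s≤s d≤k) = there (after p d≤k)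

⊆-∷ʳ⁻ : ∀ xs {x} {ys : List ℕ} → ys ⊆ xs ++ [ x ] →
  ys ⊆ xs ⊎ ∃ λ ys′ → ys ≡ ys′ ++ [ x ] × ys′ ⊆ xs
⊆-∷ʳ⁻ []       (_ ∷ʳ [])  = inj₁ []
⊆-∷ʳ⁻ []       (refl ∷ []) = inj₂ ([] , refl , [])
⊆-∷ʳ⁻ (y ∷ xs) (.y ∷ʳ s) with ⊆-∷ʳ⁻ xs s
... | inj₁ s′                = inj₁ (y ∷ʳ s′)
... | inj₂ (ys′ , refl , s′) = inj₂ (ys′ , refl , y ∷ʳ s′)
⊆-∷ʳ⁻ (y ∷ xs) (refl ∷ s) with ⊆-∷ʳ⁻ xs s
... | inj₁ s′                = inj₁ (refl ∷ s′)
... | inj₂ (ys′ , refl , s′) = inj₂ (y ∷ ys′ , refl , refl ∷ s′)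

-- A copy of π in w omits one entry of w; the positions after it shift by one, which carries
-- one of the two rises of π onto one of the two falls of w.
¬⪯-one-longer : ∀ {π w p t} → EntryLt π 0 p → EntryLt π p t → p < t →
  EntryLt w p 0 → EntryLt w (suc t) (suc p) → suc (length π) ≡ length w → ¬ π ⪯ w
¬⪯-one-longer {p = p} rise₁ rise₂ p<t fall₁ fall₂ len (ys , ys⊆w , iso)
  with d , before , after ← ⊆-one-shorter ys⊆w (trans (cong suc (sym (proj₁ iso))) len)
  with p <? d
... | yes p<d = EntryLt-asym fall₁
      (EntryLt-map (λ q → before q (≤-<-trans z≤n p<d)) (λ q → before q p<d) (OrderIso⇒EntryLt iso rise₁))
... | no p≮d = EntryLt-asym fall₂
      (EntryLt-map (λ q → after q d≤p) (λ q → after q (≤-trans d≤p (<⇒≤ p<t))) (OrderIso⇒EntryLt iso rise₂))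
  where
  d≤p : d ≤ p
  d≤p = ≮⇒≥ p≮d

⪯-∷ʳ-max : ∀ {π e w X} → All (_< X) w → (π ++ [ e ]) ⪯ (w ++ [ X ]) →
  (π ++ [ e ]) ⪯ w ⊎ All (_< e) π
⪯-∷ʳ-max {π} {e} {w} {X} w<X (ys , s , iso) with ⊆-∷ʳ⁻ w s
... | inj₁ ys⊆w = inj₁ (ys , ys⊆w , iso)
... | inj₂ (ys′ , refl , ys′⊆w) = inj₂ ([]=⇒All π below-e)
  where
  same-length : length π ≡ length ys′
  same-length = suc-injective (trans (sym (length-∷ʳ π e)) (trans (proj₁ iso) (length-∷ʳ ys′ X)))
  below-e : ∀ {k u} → π [ k ]= u → u < e
  below-e {k} p with y , q ← []=-exists ys′ (subst (k <_) same-length ([]=-bound p)) =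
    EntryLt⇒< (OrderIso⇒EntryLt (OrderIso-sym {π ++ [ e ]} {ys′ ++ [ X ]} iso) y<X) ([]=-++ˡ [ e ] p)
      (subst ((π ++ [ e ]) [_]= e) same-length ([]=-++-mid π))
    where
    y<X : EntryLt (ys′ ++ [ X ]) k (length ys′)
    y<X = y , X , []=-++ˡ _ q , []=-++-mid ys′ , All-[]= (All-resp-⊆ ys′⊆w w<X) q

↭⇒IsPerm : ∀ n {xs} → xs ↭ map suc (upTo (suc n)) → IsPerm xs
↭⇒IsPerm n {xs} xs↭ = subst (1 ≤_) (sym len) (s≤s z≤n) , subst (λ m → xs ↭ map suc (upTo m)) (sym len) xs↭
  where
  len : length xs ≡ suc n
  len = trans (↭-length xs↭) (trans (length-map suc (upTo (suc n))) (length-upTo (suc n)))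

IsPerm-↭ : ∀ {xs ys} → xs ↭ ys → IsPerm xs → IsPerm ys
IsPerm-↭ {xs} {ys} xs↭ys (1≤n , xs↭) =
  subst (1 ≤_) len 1≤n , subst (λ m → ys ↭ map suc (upTo m)) len (↭-trans (↭-sym xs↭ys) xs↭)
  where
  len : length xs ≡ length ys
  len = ↭-length xs↭ys

IsPerm-∷ʳ : ∀ {xs} → IsPerm xs → IsPerm (xs ++ [ suc (length xs) ])
IsPerm-∷ʳ {xs} (_ , xs↭) = ↭⇒IsPerm (length xs) (subst (xs ++ [ suc (length xs) ] ↭_) upTo-∷ʳ (++⁺ʳ _ xs↭))
  where
  upTo-∷ʳ : map suc (upTo (length xs)) ++ [ suc (length xs) ] ≡ map suc (upTo (suc (length xs)))
  upTo-∷ʳ = trans (sym (map-++ suc (upTo (length xs)) _)) (cong (map suc) (applyUpTo-∷ʳ (λ i → i) (length xs)))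

IsPerm⇒≤ : ∀ {xs} → IsPerm xs → All (_≤ length xs) xs
IsPerm⇒≤ (_ , xs↭) = All-resp-↭ (↭-sym xs↭) (All.map⁺ (All.tabulate ∈-upTo⁻))

¬class-of-witness : ∀ π σ → IsPerm σ → π ⪯ B σ → ¬ π ⪯ (σ ++ [ suc (length σ) ]) →
  ¬ IsPatternClass (Binv (Av π))
¬class-of-witness π σ perm-σ π⪯Bσ π⋠Bτ (_ , closed) =
  proj₂ (proj₂ (closed σ τ perm-σ (⊆⇒⪯ (X ∷ʳ ⊆-refl)) τ∈Binv)) π⪯Bσ
  where
  X : ℕ
  X = suc (length σ)
  τ : List ℕ
  τ = X ∷ σ
  Bτ : B τ ≡ σ ++ [ X ]
  Bτ = B-max-first σ (All.map m≤n⇒m≤1+n (IsPerm⇒≤ perm-σ))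
  τ∈Binv : Binv (Av π) τ
  τ∈Binv = IsPerm-↭ (↭-sym (∷↭∷ʳ X σ)) (IsPerm-∷ʳ perm-σ)
         , subst (Av π) (sym Bτ) (IsPerm-∷ʳ perm-σ , π⋠Bτ)

¬⪯-lifted : ∀ {h b G r e z t} → 0 < length h → All (_< b) h → All (_< G) (b ∷ h) → All (_< G) r →
  EntryLt (h ++ b ∷ r ++ [ e ]) (length h) t → length h < t → suc t < length (h ++ b ∷ r ++ [ e ]) →
  ¬ (h ++ b ∷ r ++ [ e ]) ⪯ ((b ∷ h ++ G ∷ r) ++ [ z ])
¬⪯-lifted {h₀ ∷ hs} {b} {G} {r} {e} {z} {t} _ h<b bh<G r<G rise h<t t<π =
  ¬⪯-one-longer first-rise rise h<t first-fall second-fall (trans (cong suc (sym same-length)) (sym (length-∷ʳ σ z)))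
  where
  h π σ : List ℕ
  h = h₀ ∷ hs
  π = h ++ b ∷ r ++ [ e ]
  σ = b ∷ h ++ G ∷ r
  same-length : length σ ≡ length π
  same-length = begin
    suc (length (h ++ G ∷ r))          ≡⟨ cong suc (length-++-sucʳ h G r) ⟩
    suc (suc (length (h ++ r)))        ≡⟨ cong suc (sym (length-∷ʳ (h ++ r) e)) ⟩
    suc (length ((h ++ r) ++ [ e ]))   ≡⟨ cong (suc ∘ length) (++-assoc h r [ e ]) ⟩
    suc (length (h ++ r ++ [ e ]))     ≡⟨ sym (length-++-sucʳ h b (r ++ [ e ])) ⟩
    length π                           ∎
    where open ≡-Reasoning
  first-rise : EntryLt π 0 (length h)
  first-rise = h₀ , b , here , []=-++-mid h , All.head h<b
  first-fall : EntryLt (σ ++ [ z ]) (length h) 0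
  first-fall with v , q ← []=-exists h ≤-refl =
    v , b , there ([]=-++ˡ [ z ] ([]=-++ˡ (G ∷ r) q)) , here , All-[]= h<b q
  second-fall : EntryLt (σ ++ [ z ]) (suc t) (suc (length h))
  second-fall with v , q ← []=-exists σ (subst (suc t <_) (sym same-length) t<π) =
    v , G , []=-++ˡ [ z ] q , []=-++ˡ [ z ] ([]=-++-mid (b ∷ h)) ,
    []=-below-peak (b ∷ h) bh<G r<G q (>⇒≢ (s≤s h<t))

module Witness {h r : List ℕ} {b e t : ℕ} (perm : IsPerm (h ++ b ∷ r ++ [ e ]))
  (0<h : 0 < length h) (h<b : All (_< b) h) (rise : EntryLt (h ++ b ∷ r ++ [ e ]) (length h) t)
  (h<t : length h < t) (t<π : suc t < length (h ++ b ∷ r ++ [ e ])) where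

  π : List ℕ
  π = h ++ b ∷ r ++ [ e ]

  ¬class-last-max : All (_< e) (h ++ b ∷ r) → ¬ IsPatternClass (Binv (Av π))
  ¬class-last-max below-e = ¬class-of-witness π σ (IsPerm-↭ (↭-sym (lift↭ h r)) perm)
    (⊆⇒⪯ (⊆-reflexive (sym Bσ≡π))) (¬⪯-lifted 0<h h<b (b<e ∷ h<e) r<e rise h<t t<π)
    where
    σ : List ℕ
    σ = b ∷ h ++ e ∷ r
    h<e : All (_< e) h
    h<e = All.++⁻ˡ h below-e
    b<e : b < e
    b<e = All.head (All.++⁻ʳ h below-e)
    r<e : All (_< e) r
    r<e = All.tail (All.++⁻ʳ h below-e)
    Bσ≡π : B σ ≡ π
    Bσ≡π = B-lift h r h<b (b<e ∷ h<e) (All.map <⇒≤ r<e)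

  ¬class-last-not-max : ¬ All (_< e) (h ++ b ∷ r) → ¬ IsPatternClass (Binv (Av π))
  ¬class-last-not-max ¬below-e =
    ¬class-of-witness π σ perm-σ (⊆⇒⪯ (subst (π ⊆_) (sym Bσ≡π∷ʳG) (Sublist.++⁺ʳ [ G ] ⊆-refl))) π⋠σX
    where
    G : ℕ
    G = suc (length π)
    σ : List ℕ
    σ = b ∷ h ++ G ∷ r ++ [ e ]
    π<G : All (_< G) π
    π<G = All.map s≤s (IsPerm⇒≤ perm)
    h<G : All (_< G) h
    h<G = All.++⁻ˡ h π<G
    b<G : b < G
    b<G = All.head (All.++⁻ʳ h π<G)
    re<G : All (_< G) (r ++ [ e ])
    re<G = All.tail (All.++⁻ʳ h π<G)
    π∷ʳG-assoc : π ++ [ G ] ≡ h ++ b ∷ (r ++ [ e ]) ++ [ G ]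
    π∷ʳG-assoc = ++-assoc h (b ∷ r ++ [ e ]) [ G ]
    Bσ≡π∷ʳG : B σ ≡ π ++ [ G ]
    Bσ≡π∷ʳG = trans (B-lift h (r ++ [ e ]) h<b (b<G ∷ h<G) (All.map <⇒≤ re<G)) (sym π∷ʳG-assoc)
    perm-σ : IsPerm σ
    perm-σ = IsPerm-↭ (↭-sym (subst (σ ↭_) (sym π∷ʳG-assoc) (lift↭ h (r ++ [ e ])))) (IsPerm-∷ʳ perm)
    π⋠σX : ¬ π ⪯ (σ ++ [ suc (length σ) ])
    π⋠σX π⪯σX
      with ⪯-∷ʳ-max (All.map s≤s (IsPerm⇒≤ perm-σ))
             (subst (_⪯ (σ ++ [ suc (length σ) ])) (sym (++-assoc h (b ∷ r) [ e ])) π⪯σX)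
    ... | inj₁ π⪯σ = ¬⪯-lifted 0<h h<b (b<G ∷ h<G) (All.++⁻ˡ r re<G) rise h<t t<π
                       (subst₂ _⪯_ (++-assoc h (b ∷ r) [ e ]) (cong (b ∷_) (sym (++-assoc h (G ∷ r) [ e ]))) π⪯σ)
    ... | inj₂ below-e = ¬below-e below-e

¬class-of-split : ∀ {π h b t} r → π ≡ h ++ b ∷ r → IsPerm π →
  0 < length h → All (_< b) h → EntryLt π (length h) t → length h < t → suc t < length π →
  ¬ IsPatternClass (Binv (Av π))
¬class-of-split {h = h} {b} {t} r π≡ perm 0<h h<b rise h<t t<π with initLast r
... | [] = ⊥-elim (<-asym h<t (s<s⁻¹ (subst (suc t <_) (trans (cong length π≡) (length-∷ʳ h b)) t<π)))
... | r′ ∷ʳ′ e with refl ← π≡ with all? (_<? e) (h ++ b ∷ r′)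
...   | yes below-e = Witness.¬class-last-max perm 0<h h<b rise h<t t<π below-e
...   | no ¬below-e = Witness.¬class-last-not-max perm 0<h h<b rise h<t t<π ¬below-e

lookup-split : ∀ (xs : List ℕ) (i : Fin (length xs)) → ∃₂ λ h r → xs ≡ h ++ lookup xs i ∷ r × length h ≡ toℕ i
lookup-split (x ∷ xs) Fin.zero    = [] , xs , refl , refl
lookup-split (x ∷ xs) (Fin.suc i) =
  let h , r , eq , len = lookup-split xs i in x ∷ h , r , cong (x ∷_) eq , cong suc len

IsLRMax⇒EntryLt : ∀ {xs i j} → IsLRMax xs i → j Fin.< i → EntryLt xs (toℕ j) (toℕ i)
IsLRMax⇒EntryLt {xs} {i} {j} lr j<i = _ , _ , lookup-[]= xs j , lookup-[]= xs i , lr j j<i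

IsLRMax⇒prefix< : ∀ {xs i h r} → IsLRMax xs i → xs ≡ h ++ lookup xs i ∷ r → length h ≡ toℕ i →
  All (_< lookup xs i) h
IsLRMax⇒prefix< {xs} {i} {h} lr eq len = []=⇒All h λ p →
  let j , j≡k , xⱼ≡v = []=⇒lookup (subst (_[ _ ]= _) (sym eq) ([]=-++ˡ _ p))
  in subst (_< lookup xs i) xⱼ≡v (lr j (subst₂ _<_ (sym j≡k) len ([]=-bound p)))

theorem2p1 : (π : List ℕ) → IsPerm π → ThirdLRMaxNotLast π →
    ¬ IsPatternClass (Binv (Av π))
theorem2p1 π perm (i₁ , i₂ , i₃ , i₁<i₂ , i₂<i₃ , _ , lr₂ , lr₃ , _ , i₃-not-last)
  with h , r , π≡ , len ← lookup-split π i₂ =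
  ¬class-of-split r π≡ perm
    (subst (0 <_) (sym len) (≤-<-trans z≤n i₁<i₂)) (IsLRMax⇒prefix< lr₂ π≡ len)
    (subst (λ p → EntryLt π p (toℕ i₃)) (sym len) (IsLRMax⇒EntryLt lr₃ i₂<i₃))
    (subst (_< toℕ i₃) (sym len) i₂<i₃) i₃-not-last
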